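{- Let $\kappa$ be a cardinal and $U$ an ultrafilter over $\kappa$. Every open subset of ${}^{\omega}\kappa$ is $U$-measurable.
   Context: ${}^{\omega}\kappa$ carries the product topology of the discrete space $\kappa$. ${}^{<\omega}\kappa$ is the set of finite sequences from $\kappa$; $\frown$ is concatenation, $\langle\rangle$ the empty sequence. A tree is a subset of ${}^{<\omega}\kappa$ closed under initial segments; $[T]$ is the set of infinite branches of $T$. For $X\subseteq{}^{\omega}\kappa$ and $\sigma\in{}^{<\omega}\kappa$, $X\lfloor\sigma=\{s:\sigma\frown s\in X\}$. A tree $T$ is $U$-branching iff $\langle\rangle\in T$ and for each $\sigma\in T$, $\{\alpha\in\kappa:\sigma\frown\langle\alpha\rangle\in T\}\in U$. $X$ is $U$-large (resp. $U$-small) iff there is a $U$-branching tree $T$ with $[T]\subseteq X$ (resp. $[T]\cap X=\emptyset$); $X$ is $U$-determined iff it is $U$-large or $U$-small; $X$ is $U$-measurable iff $X\lfloor\sigma$ is $U$-determined for every $\sigma\in{}^{<\omega}\kappa$. -}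

module Defs where

open import Data.Nat using (ℕ; zero; suc; _<_)
open import Data.List using (List; []; _∷_; _++_; [_])
open import Data.Product using (Σ; _×_)
open import Data.Sum using (_⊎_)
open import Data.Unit using (⊤)
open import Data.Empty using (⊥)
open import Relation.Nullary using (¬_)
open import Relation.Binary.PropositionalEquality using (_≡_)

-- κ is represented by an arbitrary type K; ω-sequences are functions ℕ → K.
-- Subsets of a type are Set-valued predicates.

record IsUltrafilter {K : Set} (U : (K → Set) → Set) : Set₁ where
  field
    upward : ∀ {A B : K → Set} → (∀ x → A x → B x) → U A → U B
    inter  : ∀ {A B : K → Set} → U A → U B → U (λ x → A x × B x)
    full   : U (λ _ → ⊤)
    proper : ¬ U (λ _ → ⊥)
    ultra  : ∀ (A : K → Set) → U A ⊎ U (λ x → ¬ A x)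

module _ {K : Set} where

  Seq : Set
  Seq = ℕ → K

  _⌢_ : List K → Seq → Seq
  [] ⌢ s = s
  (a ∷ σ) ⌢ s = λ { zero → a ; (suc n) → (σ ⌢ s) n }

  _⌊_ : (Seq → Set) → List K → (Seq → Set)
  (X ⌊ σ) s = X (σ ⌢ s)

  prefix : Seq → ℕ → List K
  prefix x zero = []
  prefix x (suc n) = x zero ∷ prefix (λ i → x (suc i)) n

  IsTree : (List K → Set) → Set
  IsTree T = ∀ (σ τ : List K) → T (σ ++ τ) → T σ

  Branch : (List K → Set) → Seq → Set
  Branch T x = ∀ n → T (prefix x n)

  IsUBranching : ((K → Set) → Set) → (List K → Set) → Set
  IsUBranching U T = T [] × (∀ σ → T σ → U (λ α → T (σ ++ [ α ])))

  ULarge : ((K → Set) → Set) → (Seq → Set) → Set₁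
  ULarge U X = Σ (List K → Set) λ T →
    IsTree T × IsUBranching U T × (∀ x → Branch T x → X x)

  USmall : ((K → Set) → Set) → (Seq → Set) → Set₁
  USmall U X = Σ (List K → Set) λ T →
    IsTree T × IsUBranching U T × (∀ x → Branch T x → ¬ X x)

  UDetermined : ((K → Set) → Set) → (Seq → Set) → Set₁
  UDetermined U X = ULarge U X ⊎ USmall U X

  UMeasurable : ((K → Set) → Set) → (Seq → Set) → Set₁
  UMeasurable U X = ∀ (σ : List K) → UDetermined U (X ⌊ σ)

  -- open in the product topology of the discrete space K:
  -- every point of X has a basic cylinder neighbourhood inside X
  IsOpen : (Seq → Set) → Set
  IsOpen X = ∀ x → X x → Σ ℕ λ n → ∀ y → (∀ i → i < n → y i ≡ x i) → X y

{-# OPTIONS --safe #-}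
module Submission where

-- If X is not U-large, then neither are U-many of its sections X⌊⟨α⟩: otherwise the trees
-- witnessing largeness of U-many sections graft into a U-branching tree inside X.  So the
-- nodes σ with X⌊ρ not U-large for every initial segment ρ of σ form a U-branching tree.
-- When X is open its branches avoid X: a point x ∈ X has a cylinder neighbourhood inside X,
-- and the section of X at the stem of that cylinder is everything, hence U-large.
-- Excluded middle decides largeness and resizes these Set₁-propositions into Set.

open import Defs
open import Level using (0ℓ)
open import Axiom.ExcludedMiddle using (ExcludedMiddle)
open import Data.Nat using (ℕ; zero; suc; _<_; s≤s)
open import Data.Nat.Properties using (<⇒≤)
open import Data.List using (List; []; _∷_; _++_; [_])
open import Data.Product using (_×_; _,_)
open import Data.Sum using (inj₁; inj₂)
open import Data.Unit using (⊤; tt)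
open import Data.Empty using (⊥; ⊥-elim)
open import Function using (_∘_)
open import Relation.Nullary using (¬_; Dec; yes; no)
open import Relation.Nullary.Decidable using (True; fromWitness; toWitness)
open import Relation.Binary.Definitions using (_Respects_)
open import Relation.Binary.PropositionalEquality using (_≡_; refl; sym; _≗_)

module _ {K : Set} where

  Cylinder : Seq {K} → ℕ → Seq {K} → Set
  Cylinder x n y = ∀ i → i < n → y i ≡ x i

  ⌢-cong : (σ : List K) {s t : Seq {K}} → s ≗ t → (σ ⌢ s) ≗ (σ ⌢ t)
  ⌢-cong []      s≗t i       = s≗t i
  ⌢-cong (a ∷ σ) s≗t zero    = refl
  ⌢-cong (a ∷ σ) s≗t (suc i) = ⌢-cong σ s≗t i

  ⌢-cylinder : (σ : List K) {s y : Seq {K}} {n : ℕ} → Cylinder s n y → Cylinder (σ ⌢ s) n (σ ⌢ y)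
  ⌢-cylinder []      y∈N i       i<n = y∈N i i<n
  ⌢-cylinder (a ∷ σ) y∈N zero    _   = refl
  ⌢-cylinder (a ∷ σ) y∈N (suc i) i<n = ⌢-cylinder σ y∈N i (<⇒≤ i<n)

  head⌢tail≗ : (x : Seq {K}) → ([ x zero ] ⌢ (x ∘ suc)) ≗ x
  head⌢tail≗ x zero    = refl
  head⌢tail≗ x (suc i) = refl

  ⌢-cylinder-tail : (x : Seq {K}) {n : ℕ} {y : Seq {K}} →
    Cylinder (x ∘ suc) n y → Cylinder x (suc n) ([ x zero ] ⌢ y)
  ⌢-cylinder-tail x y∈N zero    _         = refl
  ⌢-cylinder-tail x y∈N (suc i) (s≤s i<n) = y∈N i i<n

  open⇒respects : {X : Seq {K} → Set} → IsOpen X → X Respects _≗_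
  open⇒respects X-open {x} {y} x≗y x∈X =
    let (n , N⊆X) = X-open x x∈X in N⊆X y (λ i _ → sym (x≗y i))

  ⌊-respects : {X : Seq {K} → Set} → X Respects _≗_ → (σ : List K) → (X ⌊ σ) Respects _≗_
  ⌊-respects X-resp σ s≗t = X-resp (⌢-cong σ s≗t)

  ⌊-open : {X : Seq {K} → Set} → IsOpen X → (σ : List K) → IsOpen (X ⌊ σ)
  ⌊-open X-open σ s σ⌢s∈X =
    let (n , N⊆X) = X-open (σ ⌢ s) σ⌢s∈X in n , λ y y∈N → N⊆X (σ ⌢ y) (⌢-cylinder σ y∈N)

module UTrees {K : Set} (U : (K → Set) → Set) where

  GrowsIn : (List K → Set) → Set
  GrowsIn T = ∀ σ → T σ → U (λ α → T (σ ++ [ α ]))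

  Graft : (K → List K → Set) → List K → Set
  Graft T []      = ⊤
  Graft T (α ∷ τ) = T α τ

  graft-isTree : {T : K → List K → Set} → (∀ α → IsTree (T α)) → IsTree (Graft T)
  graft-isTree T-tree []      τ _ = tt
  graft-isTree T-tree (α ∷ σ) τ t = T-tree α σ τ t

  graft-isUBranching : {T : K → List K → Set} →
    U (λ α → T α []) → (∀ α → GrowsIn (T α)) → IsUBranching U (Graft T)
  graft-isUBranching roots grows = tt , λ { [] _ → roots ; (α ∷ σ) t → grows α σ t }

  WitnessTree : {Y : Seq {K} → Set} → Dec (ULarge U Y) → List K → Set
  WitnessTree (yes (T , _)) = T
  WitnessTree (no _)        = λ _ → ⊥

  module _ {Y : Seq {K} → Set} where

    witnessTree-isTree : (d : Dec (ULarge U Y)) → IsTree (WitnessTree d)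
    witnessTree-isTree (yes (_ , T-tree , _)) = T-tree
    witnessTree-isTree (no _)                 = λ _ _ ()

    witnessTree-root : (d : Dec (ULarge U Y)) → True d → WitnessTree d []
    witnessTree-root (yes (_ , _ , (root , _) , _)) _ = root

    witnessTree-grows : (d : Dec (ULarge U Y)) → GrowsIn (WitnessTree d)
    witnessTree-grows (yes (_ , _ , (_ , grows) , _)) = grows
    witnessTree-grows (no _)                          = λ _ ()

    witnessTree-branches : (d : Dec (ULarge U Y)) → ∀ x → Branch (WitnessTree d) x → Y x
    witnessTree-branches (yes (_ , _ , _ , [T]⊆Y)) = [T]⊆Y
    witnessTree-branches (no _)                    = λ _ b → ⊥-elim (b 0)

  -- The sections are taken one letter at a time because X ⌊ (σ ++ τ) and (X ⌊ σ) ⌊ τ are only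
  -- pointwise equal; a bare ¬ ULarge U (X ⌊ σ) would not be closed under initial segments.
  NotLargeAlong : (Seq {K} → Set) → List K → Set₁
  NotLargeAlong X []      = ¬ ULarge U X
  NotLargeAlong X (a ∷ σ) = ¬ ULarge U X × NotLargeAlong (X ⌊ [ a ]) σ

  notLargeAlong-++⁻ˡ : ∀ (X : Seq {K} → Set) σ τ → NotLargeAlong X (σ ++ τ) → NotLargeAlong X σ
  notLargeAlong-++⁻ˡ X []      []      ¬large         = ¬large
  notLargeAlong-++⁻ˡ X []      (a ∷ τ) (¬large , _)   = ¬large
  notLargeAlong-++⁻ˡ X (a ∷ σ) τ       (¬large , nla) = ¬large , notLargeAlong-++⁻ˡ (X ⌊ [ a ]) σ τ nla

  full⇒large : U (λ _ → ⊤) → {X : Seq {K} → Set} → (∀ y → X y) → ULarge U X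
  full⇒large U-full X-full = (λ _ → ⊤) , (λ _ _ _ → tt) , (tt , λ _ _ → U-full) , (λ x _ → X-full x)

  notLargeAlong-prefix⇒¬cylinder⊆ : U (λ _ → ⊤) → ∀ n (X : Seq {K} → Set) (x : Seq {K}) →
    NotLargeAlong X (prefix x n) → ¬ (∀ y → Cylinder x n y → X y)
  notLargeAlong-prefix⇒¬cylinder⊆ U-full zero    X x ¬large    N⊆X =
    ¬large (full⇒large U-full (λ y → N⊆X y (λ _ ())))
  notLargeAlong-prefix⇒¬cylinder⊆ U-full (suc n) X x (_ , nla) N⊆X =
    notLargeAlong-prefix⇒¬cylinder⊆ U-full n (X ⌊ [ x zero ]) (x ∘ suc) nla
      (λ y y∈N → N⊆X ([ x zero ] ⌢ y) (⌢-cylinder-tail x y∈N))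

module _ (lem : ExcludedMiddle (Level.suc 0ℓ)) {K : Set} {U : (K → Set) → Set}
         (isU : IsUltrafilter U) where
  open IsUltrafilter isU
  open UTrees U

  Resize : Set₁ → Set
  Resize P = True (lem {P})

  resize-¬ : {P : Set₁} → ¬ Resize P → Resize (¬ P)
  resize-¬ ¬p = fromWitness (λ p → ¬p (fromWitness p))

  -- Respecting _≗_ replaces function extensionality: a branch x of the graft only yields
  -- [ x zero ] ⌢ (x ∘ suc) ∈ X.
  U-many-large-sections⇒large : {X : Seq {K} → Set} → X Respects _≗_ →
    U (λ α → Resize (ULarge U (X ⌊ [ α ]))) → ULarge U X
  U-many-large-sections⇒large {X} X-resp many-large =
    Graft (λ α → WitnessTree (large? α)) , graft-isTree (witnessTree-isTree ∘ large?) ,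
    graft-isUBranching (upward (witnessTree-root ∘ large?) many-large) (witnessTree-grows ∘ large?) ,
    λ x b → X-resp (head⌢tail≗ x) (witnessTree-branches (large? (x zero)) (x ∘ suc) (b ∘ suc))
    where
    large? : ∀ α → Dec (ULarge U (X ⌊ [ α ]))
    large? α = lem

  notLarge⇒U-many-notLarge-sections : {X : Seq {K} → Set} → X Respects _≗_ →
    ¬ ULarge U X → U (λ α → Resize (¬ ULarge U (X ⌊ [ α ])))
  notLarge⇒U-many-notLarge-sections {X} X-resp ¬large with ultra (λ α → Resize (ULarge U (X ⌊ [ α ])))
  ... | inj₁ many-large    = ⊥-elim (¬large (U-many-large-sections⇒large X-resp many-large))
  ... | inj₂ many-notLarge = upward (λ _ → resize-¬) many-notLarge

  notLargeAlong-grows : {X : Seq {K} → Set} → X Respects _≗_ →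
    GrowsIn (Resize ∘ NotLargeAlong X)
  notLargeAlong-grows X-resp [] nla =
    upward (λ _ ¬large-α → fromWitness (toWitness nla , toWitness ¬large-α))
           (notLarge⇒U-many-notLarge-sections X-resp (toWitness nla))
  notLargeAlong-grows X-resp (a ∷ σ) nla =
    let (¬large , nla-a) = toWitness nla in
    upward (λ _ nla-a-α → fromWitness (¬large , toWitness nla-a-α))
           (notLargeAlong-grows (⌊-respects X-resp [ a ]) σ (fromWitness nla-a))

  notLarge⇒small : {X : Seq {K} → Set} → IsOpen X → ¬ ULarge U X → USmall U X
  notLarge⇒small {X} X-open ¬large =
    Resize ∘ NotLargeAlong X , (λ σ τ t → fromWitness (notLargeAlong-++⁻ˡ X σ τ (toWitness t))) ,
    (fromWitness ¬large , notLargeAlong-grows (open⇒respects X-open)) ,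
    λ x b x∈X → let (n , N⊆X) = X-open x x∈X in
                notLargeAlong-prefix⇒¬cylinder⊆ full n X x (toWitness (b n)) N⊆X

  open⇒determined : {X : Seq {K} → Set} → IsOpen X → UDetermined U X
  open⇒determined {X} X-open with lem {ULarge U X}
  ... | yes large = inj₁ large
  ... | no ¬large = inj₂ (notLarge⇒small X-open ¬large)

theorem5p5 : ExcludedMiddle (Level.suc 0ℓ) → (K : Set) → (U : (K → Set) → Set) → IsUltrafilter U →
    (X : Seq {K} → Set) → IsOpen X → UMeasurable U X
theorem5p5 lem K U isU X X-open σ = open⇒determined lem isU (⌊-open X-open σ)
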